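{- Let $\mathcal{L}$ be a lattice-oriented signature and let $\mathsf{K}$ be any class of $\mathcal{L}$-lattices. Then there is a one-to-one correspondence between the members of $m\mathsf{K}$ and the ordered pairs $\langle\mathbf{A},\mathbf{A}_0\rangle$ where $\mathbf{A}\in\mathsf{K}$ and $\mathbf{A}_0$ is a relatively complete subalgebra of $\mathbf{A}$, implemented by the maps $\langle\mathbf{A},\Box,\Diamond\rangle\mapsto\langle\mathbf{A},\Box\mathbf{A}\rangle$ and $\langle\mathbf{A},\mathbf{A}_0\rangle\mapsto\langle\mathbf{A},\Box_0,\Diamond_0\rangle$. Here $\Box\mathbf{A}$ is the subalgebra of $\mathbf{A}$ with universe $\{\Box a\mid a\in A\}$, and $\Box_0 a:=\max\{b\in A_0\mid b\le a\}$, $\Diamond_0 a:=\min\{b\in A_0\mid a\le b\}$ for $a\in A$.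
   Context: A signature $\mathcal{L}$ is lattice-oriented if its set of binary operation symbols contains distinct symbols $\land$ and $\lor$. An $\mathcal{L}$-lattice is an algebra of signature $\mathcal{L}$ whose $\{\land,\lor\}$-reduct is a lattice, with order $x\le y$ iff $x\land y=x$. A subalgebra $\mathbf{A}_0$ of $\mathbf{A}$ is relatively complete if for every $a\in A$ the set $\{b\in A_0\mid b\le a\}$ has a maximum and $\{b\in A_0\mid a\le b\}$ has a minimum. An m-$\mathcal{L}$-lattice is a structure $\langle\mathbf{A},\Box,\Diamond\rangle$ where $\mathbf{A}$ is an $\mathcal{L}$-lattice and $\Box,\Diamond$ are unary operations satisfying $\Box x\land x\approx\Box x$, $\Diamond x\lor x\approx \Diamond x$, $\Box(x\land y)\approx\Box x\land\Box y$, $\Diamond(x\lor y)\approx\Diamond x\lor\Diamond y$, $\Box\Diamond x\approx\Diamond x$, $\Diamond\Box x\approx\Box x$, and, for every $n$-ary $\star\in\mathcal{L}$, $\Box(\star(\Box x_1,\dots,\Box x_n))\approx\star(\Box x_1,\dots,\Box x_n)$. For a class $\mathsf{K}$ of $\mathcal{L}$-lattices, $m\mathsf{K}$ denotes the class of all m-$\mathcal{L}$-lattices $\langle\mathbf{A},\Box,\Diamond\rangle$ with $\mathbf{A}\in\mathsf{K}$. -}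

module Defs where

open import Level using (Level; _⊔_; suc)
open import Data.Nat using (ℕ)
open import Data.Vec using (Vec; []; _∷_; map)
open import Data.Vec.Relation.Unary.All using (All)
open import Data.Product using (Σ; _×_; ∃)
open import Relation.Binary.PropositionalEquality using (_≡_; _≢_)
open import Relation.Unary using (Pred)
open import Algebra.Lattice.Structures using (IsLattice)

record Signature (o : Level) : Set (suc o) where
  field
    Op    : ℕ → Set o
    ∧ₛ    : Op 2
    ∨ₛ    : Op 2
    ∧≢∨   : ∧ₛ ≢ ∨ₛ
open Signature public

record Algebra {o : Level} (𝓛 : Signature o) (c : Level) : Set (o ⊔ suc c) where
  field
    Carrier : Set c
    ⟦_⟧     : ∀ {n} → Op 𝓛 n → Vec Carrier n → Carrier

  _⊓_ : Carrier → Carrier → Carrier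
  x ⊓ y = ⟦ ∧ₛ 𝓛 ⟧ (x ∷ y ∷ [])

  _⊔ₐ_ : Carrier → Carrier → Carrier
  x ⊔ₐ y = ⟦ ∨ₛ 𝓛 ⟧ (x ∷ y ∷ [])

  _≤_ : Carrier → Carrier → Set c
  x ≤ y = x ⊓ y ≡ x

record LLattice {o : Level} (𝓛 : Signature o) (c : Level) : Set (o ⊔ suc c) where
  field
    algebra   : Algebra 𝓛 c
  open Algebra algebra public
  field
    isLattice : IsLattice _≡_ _⊔ₐ_ _⊓_

module _ {o c : Level} {𝓛 : Signature o} (A : LLattice 𝓛 c) where
  open LLattice A

  IsSubalgebra : Pred Carrier c → Set (o ⊔ c)
  IsSubalgebra S = ∀ {n} (f : Op 𝓛 n) (xs : Vec Carrier n) → All S xs → S (⟦ f ⟧ xs)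

  IsMaxBelow : Pred Carrier c → Carrier → Carrier → Set c
  IsMaxBelow S a b = S b × b ≤ a × (∀ x → S x → x ≤ a → x ≤ b)

  IsMinAbove : Pred Carrier c → Carrier → Carrier → Set c
  IsMinAbove S a b = S b × a ≤ b × (∀ x → S x → a ≤ x → b ≤ x)

  record IsRelCompleteSubalgebra (S : Pred Carrier c) : Set (o ⊔ c) where
    field
      subalgebra : IsSubalgebra S
      maxBelow   : ∀ a → ∃ (IsMaxBelow S a)
      minAbove   : ∀ a → ∃ (IsMinAbove S a)

  record IsMStructure (□ ◇ : Carrier → Carrier) : Set (o ⊔ c) where
    field
      □-deflat  : ∀ x → □ x ⊓ x ≡ □ x
      ◇-inflat  : ∀ x → ◇ x ⊔ₐ x ≡ ◇ x
      □-meet    : ∀ x y → □ (x ⊓ y) ≡ □ x ⊓ □ y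
      ◇-join    : ∀ x y → ◇ (x ⊔ₐ y) ≡ ◇ x ⊔ₐ ◇ y
      □◇        : ∀ x → □ (◇ x) ≡ ◇ x
      ◇□        : ∀ x → ◇ (□ x) ≡ □ x
      □-op      : ∀ {n} (f : Op 𝓛 n) (xs : Vec Carrier n) →
                  □ (⟦ f ⟧ (map □ xs)) ≡ ⟦ f ⟧ (map □ xs)

  BoxImage : (Carrier → Carrier) → Pred Carrier c
  BoxImage □ x = Σ Carrier (λ a → □ a ≡ x)

  □₀ : {S : Pred Carrier c} → IsRelCompleteSubalgebra S → Carrier → Carrier
  □₀ rc a = Data.Product.proj₁ (IsRelCompleteSubalgebra.maxBelow rc a)

  ◇₀ : {S : Pred Carrier c} → IsRelCompleteSubalgebra S → Carrier → Carrier
  ◇₀ rc a = Data.Product.proj₁ (IsRelCompleteSubalgebra.minAbove rc a)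

-- Each pair (□, ◇) is recovered from its set of fixed points, which is □A:
-- □ a is the largest fixed point below a and ◇ a the smallest above it.
-- Conversely, for a relatively complete subalgebra A₀ the maps □₀, ◇₀ fix
-- exactly A₀, and each m-lattice law follows from uniqueness of extremal
-- elements: for instance □₀ x ∧ □₀ y is the largest element of A₀ below x ∧ y.
module Submission where

open import Defs
open import Level using (Level)
open import Data.Product using (_×_; _,_; proj₁; proj₂)
open import Data.Vec using (Vec; []; _∷_; map)
open import Data.Vec.Relation.Unary.All using (All; []; _∷_)
open import Relation.Binary.PropositionalEquality
  using (_≡_; refl; sym; trans; cong; cong₂; subst; module ≡-Reasoning)
open import Relation.Unary using (Pred)
open import Function.Bundles using (_⇔_; mk⇔)
open import Algebra.Lattice.Properties.Lattice using (∨-∧-orderTheoreticLattice)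
import Relation.Binary.Lattice as Order
import Relation.Binary.Lattice.Properties.JoinSemilattice as JoinSemilatticeProperties

module LatticeOrder {o c : Level} {𝓛 : Signature o} (A : LLattice 𝓛 c) where
  open LLattice A

  private
    orderLattice : Order.Lattice c c c
    orderLattice = ∨-∧-orderTheoreticLattice (record { isLattice = isLattice })
    module O = Order.Lattice orderLattice
    module J = JoinSemilatticeProperties O.joinSemilattice

  -- The library orders by x ≡ x ∧ y, Defs by x ∧ y ≡ x; hence the sym's.
  ≤-refl : ∀ {x} → x ≤ x
  ≤-refl = sym O.refl

  ≤-trans : ∀ {x y z} → x ≤ y → y ≤ z → x ≤ z
  ≤-trans p q = sym (O.trans (sym p) (sym q))

  ≤-antisym : ∀ {x y} → x ≤ y → y ≤ x → x ≡ y
  ≤-antisym p q = O.antisym (sym p) (sym q)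

  x∧y≤x : ∀ x y → (x ⊓ y) ≤ x
  x∧y≤x x y = sym (O.x∧y≤x x y)

  x∧y≤y : ∀ x y → (x ⊓ y) ≤ y
  x∧y≤y x y = sym (O.x∧y≤y x y)

  ∧-greatest : ∀ {x y z} → x ≤ y → x ≤ z → x ≤ (y ⊓ z)
  ∧-greatest p q = sym (O.∧-greatest (sym p) (sym q))

  x≤x∨y : ∀ x y → x ≤ (x ⊔ₐ y)
  x≤x∨y x y = sym (O.x≤x∨y x y)

  y≤x∨y : ∀ x y → y ≤ (x ⊔ₐ y)
  y≤x∨y x y = sym (O.y≤x∨y x y)

  ∨-least : ∀ {x y z} → x ≤ z → y ≤ z → (x ⊔ₐ y) ≤ z
  ∨-least p q = sym (O.∨-least (sym p) (sym q))

  x≤y⇒y∨x≡y : ∀ {x y} → x ≤ y → y ⊔ₐ x ≡ y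
  x≤y⇒y∨x≡y {x} {y} p = trans (J.∨-comm y x) (J.x≤y⇒x∨y≈y (sym p))

module ExtremalElements {o c : Level} {𝓛 : Signature o} (A : LLattice 𝓛 c)
                        (S : Pred (LLattice.Carrier A) c) where
  open LLattice A
  open LatticeOrder A

  IsMeetClosed : Set c
  IsMeetClosed = ∀ {x y} → S x → S y → S (x ⊓ y)

  IsJoinClosed : Set c
  IsJoinClosed = ∀ {x y} → S x → S y → S (x ⊔ₐ y)

  maxBelow-unique : ∀ {a b b′} → IsMaxBelow A S a b → IsMaxBelow A S a b′ → b ≡ b′
  maxBelow-unique (sb , b≤a , maxb) (sb′ , b′≤a , maxb′) =
    ≤-antisym (maxb′ _ sb b≤a) (maxb _ sb′ b′≤a)

  minAbove-unique : ∀ {a b b′} → IsMinAbove A S a b → IsMinAbove A S a b′ → b ≡ b′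
  minAbove-unique (sb , a≤b , minb) (sb′ , a≤b′ , minb′) =
    ≤-antisym (minb _ sb′ a≤b′) (minb′ _ sb a≤b)

  maxBelow-self : ∀ {s} → S s → IsMaxBelow A S s s
  maxBelow-self ss = ss , ≤-refl , λ _ _ x≤s → x≤s

  minAbove-self : ∀ {s} → S s → IsMinAbove A S s s
  minAbove-self ss = ss , ≤-refl , λ _ _ s≤x → s≤x

  maxBelow-∧ : IsMeetClosed → ∀ {x y bx by} →
               IsMaxBelow A S x bx → IsMaxBelow A S y by →
               IsMaxBelow A S (x ⊓ y) (bx ⊓ by)
  maxBelow-∧ closed {x} {y} (sbx , bx≤x , maxx) (sby , by≤y , maxy) =
      closed sbx sby
    , ∧-greatest (≤-trans (x∧y≤x _ _) bx≤x) (≤-trans (x∧y≤y _ _) by≤y)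
    , λ s ss s≤x∧y → ∧-greatest (maxx s ss (≤-trans s≤x∧y (x∧y≤x x y)))
                                (maxy s ss (≤-trans s≤x∧y (x∧y≤y x y)))

  minAbove-∨ : IsJoinClosed → ∀ {x y dx dy} →
               IsMinAbove A S x dx → IsMinAbove A S y dy →
               IsMinAbove A S (x ⊔ₐ y) (dx ⊔ₐ dy)
  minAbove-∨ closed {x} {y} (sdx , x≤dx , minx) (sdy , y≤dy , miny) =
      closed sdx sdy
    , ∨-least (≤-trans x≤dx (x≤x∨y _ _)) (≤-trans y≤dy (y≤x∨y _ _))
    , λ s ss x∨y≤s → ∨-least (minx s ss (≤-trans (x≤x∨y x y) x∨y≤s))
                             (miny s ss (≤-trans (y≤x∨y x y) x∨y≤s))

module MStructure {o c : Level} {𝓛 : Signature o} {A : LLattice 𝓛 c}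
                  {□ ◇ : LLattice.Carrier A → LLattice.Carrier A}
                  (m : IsMStructure A □ ◇) where
  open LLattice A
  open LatticeOrder A
  open ExtremalElements A (BoxImage A □)
  open IsMStructure m

  □-idem : ∀ a → □ (□ a) ≡ □ a
  □-idem a = begin
    □ (□ a)     ≡⟨ cong □ (◇□ a) ⟨
    □ (◇ (□ a)) ≡⟨ □◇ (□ a) ⟩
    ◇ (□ a)     ≡⟨ ◇□ a ⟩
    □ a         ∎
    where open ≡-Reasoning

  □-fixes-image : ∀ {x} → BoxImage A □ x → □ x ≡ x
  □-fixes-image (a , refl) = □-idem a

  ◇-fixes-image : ∀ {x} → BoxImage A □ x → ◇ x ≡ x
  ◇-fixes-image (a , refl) = ◇□ a

  □-fixes-all : ∀ {n} {xs : Vec Carrier n} → All (BoxImage A □) xs → map □ xs ≡ xs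
  □-fixes-all []       = refl
  □-fixes-all (p ∷ ps) = cong₂ _∷_ (□-fixes-image p) (□-fixes-all ps)

  □-mono : ∀ {x y} → x ≤ y → □ x ≤ □ y
  □-mono {x} {y} x≤y = trans (sym (□-meet x y)) (cong □ x≤y)

  ◇-mono : ∀ {x y} → x ≤ y → ◇ x ≤ ◇ y
  ◇-mono {x} {y} x≤y =
    subst (◇ x ≤_) (trans (sym (◇-join y x)) (cong ◇ (x≤y⇒y∨x≡y x≤y)))
          (y≤x∨y (◇ y) (◇ x))

  boxImage-isSubalgebra : IsSubalgebra A (BoxImage A □)
  boxImage-isSubalgebra f xs ps = ⟦ f ⟧ xs ,
    subst (λ v → □ (⟦ f ⟧ v) ≡ ⟦ f ⟧ v) (□-fixes-all ps) (□-op f xs)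

  □-isMaxBelow : ∀ a → IsMaxBelow A (BoxImage A □) a (□ a)
  □-isMaxBelow a = (a , refl) , □-deflat a ,
    λ x x∈□A x≤a → subst (_≤ □ a) (□-fixes-image x∈□A) (□-mono x≤a)

  ◇-isMinAbove : ∀ a → IsMinAbove A (BoxImage A □) a (◇ a)
  ◇-isMinAbove a = (◇ a , □◇ a) , subst (a ≤_) (◇-inflat a) (y≤x∨y (◇ a) a) ,
    λ x x∈□A a≤x → subst (◇ a ≤_) (◇-fixes-image x∈□A) (◇-mono a≤x)

  boxImage-isRelComplete : IsRelCompleteSubalgebra A (BoxImage A □)
  boxImage-isRelComplete = record
    { subalgebra = boxImage-isSubalgebra
    ; maxBelow   = λ a → □ a , □-isMaxBelow a
    ; minAbove   = λ a → ◇ a , ◇-isMinAbove a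
    }

  □◇-determined-by-image : (rc : IsRelCompleteSubalgebra A (BoxImage A □)) →
                           ∀ a → (□₀ A rc a ≡ □ a) × (◇₀ A rc a ≡ ◇ a)
  □◇-determined-by-image rc a =
      maxBelow-unique (proj₂ (IsRelCompleteSubalgebra.maxBelow rc a)) (□-isMaxBelow a)
    , minAbove-unique (proj₂ (IsRelCompleteSubalgebra.minAbove rc a)) (◇-isMinAbove a)

module RelCompleteSubalgebra {o c : Level} {𝓛 : Signature o} {A : LLattice 𝓛 c}
                             {S : Pred (LLattice.Carrier A) c}
                             (rc : IsRelCompleteSubalgebra A S) where
  open LLattice A
  open LatticeOrder A
  open ExtremalElements A S
  open IsRelCompleteSubalgebra rc

  □₀-isMaxBelow : ∀ a → IsMaxBelow A S a (□₀ A rc a)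
  □₀-isMaxBelow a = proj₂ (maxBelow a)

  ◇₀-isMinAbove : ∀ a → IsMinAbove A S a (◇₀ A rc a)
  ◇₀-isMinAbove a = proj₂ (minAbove a)

  □₀∈S : ∀ a → S (□₀ A rc a)
  □₀∈S a = proj₁ (□₀-isMaxBelow a)

  ◇₀∈S : ∀ a → S (◇₀ A rc a)
  ◇₀∈S a = proj₁ (◇₀-isMinAbove a)

  □₀-fixes-S : ∀ {s} → S s → □₀ A rc s ≡ s
  □₀-fixes-S ss = maxBelow-unique (□₀-isMaxBelow _) (maxBelow-self ss)

  ◇₀-fixes-S : ∀ {s} → S s → ◇₀ A rc s ≡ s
  ◇₀-fixes-S ss = minAbove-unique (◇₀-isMinAbove _) (minAbove-self ss)

  S-meetClosed : IsMeetClosed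
  S-meetClosed {x} {y} sx sy = subalgebra (∧ₛ 𝓛) (x ∷ y ∷ []) (sx ∷ sy ∷ [])

  S-joinClosed : IsJoinClosed
  S-joinClosed {x} {y} sx sy = subalgebra (∨ₛ 𝓛) (x ∷ y ∷ []) (sx ∷ sy ∷ [])

  □₀-all∈S : ∀ {n} (xs : Vec Carrier n) → All S (map (□₀ A rc) xs)
  □₀-all∈S []       = []
  □₀-all∈S (x ∷ xs) = □₀∈S x ∷ □₀-all∈S xs

  □₀◇₀-isMStructure : IsMStructure A (□₀ A rc) (◇₀ A rc)
  □₀◇₀-isMStructure = record
    { □-deflat = λ x → proj₁ (proj₂ (□₀-isMaxBelow x))
    ; ◇-inflat = λ x → x≤y⇒y∨x≡y (proj₁ (proj₂ (◇₀-isMinAbove x)))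
    ; □-meet   = λ x y → maxBelow-unique (□₀-isMaxBelow (x ⊓ y))
                   (maxBelow-∧ S-meetClosed (□₀-isMaxBelow x) (□₀-isMaxBelow y))
    ; ◇-join   = λ x y → minAbove-unique (◇₀-isMinAbove (x ⊔ₐ y))
                   (minAbove-∨ S-joinClosed (◇₀-isMinAbove x) (◇₀-isMinAbove y))
    ; □◇       = λ x → □₀-fixes-S (◇₀∈S x)
    ; ◇□       = λ x → ◇₀-fixes-S (□₀∈S x)
    ; □-op     = λ f xs → □₀-fixes-S (subalgebra f (map (□₀ A rc) xs) (□₀-all∈S xs))
    }

  S⇔□₀-image : ∀ x → S x ⇔ BoxImage A (□₀ A rc) x
  S⇔□₀-image x = mk⇔ (λ sx → x , □₀-fixes-S sx) λ { (a , refl) → □₀∈S a }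

theorem3p4 : ∀ {o c ℓ : Level} (𝓛 : Signature o) (K : Pred (LLattice 𝓛 c) ℓ)
             (A : LLattice 𝓛 c) → K A →
             ((□ ◇ : LLattice.Carrier A → LLattice.Carrier A) → IsMStructure A □ ◇ →
               IsRelCompleteSubalgebra A (BoxImage A □))
             × (∀ (S : Pred (LLattice.Carrier A) c) (rc : IsRelCompleteSubalgebra A S) →
               IsMStructure A (□₀ A rc) (◇₀ A rc))
             × ((□ ◇ : LLattice.Carrier A → LLattice.Carrier A) → IsMStructure A □ ◇ →
               (rc : IsRelCompleteSubalgebra A (BoxImage A □)) →
               ∀ a → (□₀ A rc a ≡ □ a) × (◇₀ A rc a ≡ ◇ a))
             × (∀ (S : Pred (LLattice.Carrier A) c) (rc : IsRelCompleteSubalgebra A S) →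
               ∀ x → S x ⇔ BoxImage A (□₀ A rc) x)
theorem3p4 𝓛 K A _ =
    (λ □ ◇ m → MStructure.boxImage-isRelComplete m)
  , (λ S rc → RelCompleteSubalgebra.□₀◇₀-isMStructure rc)
  , (λ □ ◇ m → MStructure.□◇-determined-by-image m)
  , (λ S rc → RelCompleteSubalgebra.S⇔□₀-image rc)
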